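{- If $G$ is a connected $6$-$\gamma_{tR}$-edge-supercritical graph, then $2\leq\operatorname{diam}(G)\leq 3$.
   Context: All graphs are finite and simple. A total Roman dominating function (TRD-function) on a graph $G$ with no isolated vertices is a function $f:V(G)\to\{0,1,2\}$ such that every vertex $v$ with $f(v)=0$ is adjacent to some $u$ with $f(u)=2$, and the subgraph induced by $\{w:f(w)>0\}$ has no isolated vertices; its weight is $\sum_v f(v)$ and $\gamma_{tR}(G)$ is the minimum weight. A graph $G$ with no isolated vertices is $k$-$\gamma_{tR}$-edge-supercritical if $\gamma_{tR}(G)=k$, $E(\overline{G})\neq\emptyset$, and $\gamma_{tR}(G+e)\leq\gamma_{tR}(G)-2$ for every $e\in E(\overline{G})$. -}

module Defs where

open import Data.Nat using (ℕ; zero; suc; _+_; _∸_; _≤_)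
open import Data.Fin using (Fin; toℕ; _≟_)
open import Data.Bool using (Bool; true; false; _∨_; _∧_)
open import Data.List using (List; map)
open import Data.Nat.ListAction using (sum)
open import Data.List using () renaming (allFin to allFinL)
open import Data.Product using (Σ; ∃; _×_; ∃-syntax)
open import Relation.Nullary using (¬_)
open import Relation.Nullary.Decidable using (⌊_⌋)
open import Relation.Binary.PropositionalEquality using (_≡_; _≢_)

record Graph (n : ℕ) : Set where
  field
    adj    : Fin n → Fin n → Bool
    sym    : ∀ u v → adj u v ≡ adj v u
    irrefl : ∀ v → adj v v ≡ false
open Graph public

Adj : {n : ℕ} → (Fin n → Fin n → Bool) → Fin n → Fin n → Set
Adj A u v = A u v ≡ true

NonEdge : {n : ℕ} → Graph n → Fin n → Fin n → Set
NonEdge G u v = (u ≢ v) × (adj G u v ≡ false)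

addEdge : {n : ℕ} → (Fin n → Fin n → Bool) → Fin n → Fin n → (Fin n → Fin n → Bool)
addEdge A u v x y =
  A x y ∨ ((⌊ x ≟ u ⌋ ∧ ⌊ y ≟ v ⌋) ∨ (⌊ x ≟ v ⌋ ∧ ⌊ y ≟ u ⌋))

NoIsolated : {n : ℕ} → (Fin n → Fin n → Bool) → Set
NoIsolated A = ∀ v → ∃[ u ] Adj A v u

weight : {n : ℕ} → (Fin n → Fin 3) → ℕ
weight {n} f = sum (map (λ v → toℕ (f v)) (allFinL n))

IsTRDF : {n : ℕ} → (Fin n → Fin n → Bool) → (Fin n → Fin 3) → Set
IsTRDF A f =
  (∀ v → toℕ (f v) ≡ 0 → ∃[ u ] (Adj A v u × toℕ (f u) ≡ 2)) ×
  (∀ v → toℕ (f v) ≢ 0 → ∃[ u ] (Adj A v u × toℕ (f u) ≢ 0))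

γtR≡ : {n : ℕ} → (Fin n → Fin n → Bool) → ℕ → Set
γtR≡ A k =
  (∃[ f ] (IsTRDF A f × weight f ≡ k)) ×
  (∀ f → IsTRDF A f → k ≤ weight f)

γtR≤ : {n : ℕ} → (Fin n → Fin n → Bool) → ℕ → Set
γtR≤ A k = ∃[ f ] (IsTRDF A f × weight f ≤ k)

EdgeSupercritical : {n : ℕ} → ℕ → Graph n → Set
EdgeSupercritical k G =
  NoIsolated (adj G) ×
  γtR≡ (adj G) k ×
  (∃[ u ] ∃[ v ] NonEdge G u v) ×
  (∀ u v → NonEdge G u v → γtR≤ (addEdge (adj G) u v) (k ∸ 2))

data Walk {n : ℕ} (G : Graph n) : Fin n → Fin n → ℕ → Set where
  here : ∀ {u} → Walk G u u 0
  step : ∀ {u w v k} → Adj (adj G) u w → Walk G w v k → Walk G u v (suc k)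

Connected : {n : ℕ} → Graph n → Set
Connected G = ∀ u v → ∃[ k ] Walk G u v k

Dist : {n : ℕ} → Graph n → Fin n → Fin n → ℕ → Set
Dist G u v d = Walk G u v d × (∀ k → Walk G u v k → d ≤ k)

Diam : {n : ℕ} → Graph n → ℕ → Set
Diam G d =
  (∀ u v → ∃[ e ] (Dist G u v e × e ≤ d)) ×
  (∃[ u ] ∃[ v ] Dist G u v d)

-- Suppose dist(x, y) ≥ 4. Supercriticality gives a TRD-function g of G + xy of
-- weight at most 4, and g is then already a TRD-function of G, contradicting
-- γ_tR(G) = 6. Away from x and y the two graphs have the same edges, and every
-- vertex v has a neighbour w with g(v) + g(w) ≥ 2. So only the conditions at x
-- and y can fail, and each failure yields four distinct vertices of total weight
-- at least 5, the distance between x and y keeping them apart. The exception is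
-- g(x) = 2, g(y) ≥ 1: then N[x] ∪ N[y] is the whole vertex set, so an x–y walk
-- (G is connected) must step from N[x] to N[y], giving a walk of length ≤ 3.
-- Hence the diameter is at most 3; a non-edge makes it at least 2.
module Submission where

open import Defs hiding (sym)
open import Function using (_∘_; id)
open import Data.Nat using (ℕ; zero; suc; _+_; _≤_; _<_; z≤n; s≤s)
open import Data.Nat.Properties
  using (≤-refl; ≤-trans; ≤-reflexive; <⇒≤; <⇒≱; ≮⇒≥; ≤∧≢⇒<; ≤-pred; n≤1+n;
         +-mono-≤; +-monoʳ-≤; +-identityʳ; n≢0⇒n>0; anyUpTo?; +-commutativeSemigroup)
import Data.Nat.Properties as ℕ
open import Data.Nat.Induction using (<-rec)
open import Data.Nat.ListAction using (sum)
open import Data.Fin using (Fin; zero; suc; toℕ; _≟_)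
open import Data.Fin.Properties using (any?)
open import Data.Bool using (Bool; true; false; _∨_; _∧_)
import Data.Bool.Properties as Bool
open import Data.List using (List; []; _∷_; map; tabulate)
open import Data.List.Properties using (map-tabulate; map-cong-local)
open import Data.List.Relation.Unary.All using (All; []; _∷_)
import Data.List.Relation.Unary.All as All
open import Data.List.Relation.Unary.AllPairs using ([]; _∷_)
open import Data.List.Relation.Unary.Unique.Propositional using (Unique)
open import Data.Product using (_×_; ∃-syntax; _,_; proj₁; proj₂)
open import Data.Sum using (_⊎_; inj₁; inj₂)
open import Data.Empty using (⊥; ⊥-elim)
open import Relation.Nullary using (¬_; Dec; yes; no)
open import Relation.Nullary.Decidable using (⌊_⌋; _×-dec_; _⊎-dec_; ¬?; decidable-stable)
open import Relation.Binary.PropositionalEquality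
open import Algebra.Properties.CommutativeSemigroup +-commutativeSemigroup using (x∙yz≈y∙xz)

private
  variable
    n k : ℕ

∑ : (Fin n → ℕ) → ℕ
∑ h = sum (tabulate h)

weight≡∑ : (f : Fin n → Fin 3) → weight f ≡ ∑ (toℕ ∘ f)
weight≡∑ f = cong sum (map-tabulate id (toℕ ∘ f))

zeroAt : Fin n → (Fin n → ℕ) → Fin n → ℕ
zeroAt zero    h zero    = 0
zeroAt zero    h (suc b) = h (suc b)
zeroAt (suc a) h zero    = h zero
zeroAt (suc a) h (suc b) = zeroAt a (h ∘ suc) b

zeroAt-≢ : ∀ a (h : Fin n → ℕ) {b} → b ≢ a → zeroAt a h b ≡ h b
zeroAt-≢ zero    h {zero}  b≢a = ⊥-elim (b≢a refl)
zeroAt-≢ zero    h {suc b} b≢a = refl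
zeroAt-≢ (suc a) h {zero}  b≢a = refl
zeroAt-≢ (suc a) h {suc b} b≢a = zeroAt-≢ a (h ∘ suc) (b≢a ∘ cong suc)

∑-zeroAt : ∀ a (h : Fin n → ℕ) → ∑ h ≡ h a + ∑ (zeroAt a h)
∑-zeroAt zero    h = refl
∑-zeroAt (suc a) h = begin
  h zero + ∑ (h ∘ suc)                              ≡⟨ cong (h zero +_) (∑-zeroAt a (h ∘ suc)) ⟩
  h zero + (h (suc a) + ∑ (zeroAt a (h ∘ suc)))     ≡⟨ x∙yz≈y∙xz (h zero) (h (suc a)) _ ⟩
  h (suc a) + (h zero + ∑ (zeroAt a (h ∘ suc)))     ∎
  where open ≡-Reasoning

sum-map≤∑ : (h : Fin n → ℕ) {vs : List (Fin n)} → Unique vs → sum (map h vs) ≤ ∑ h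
sum-map≤∑ h {[]}     []               = z≤n
sum-map≤∑ h {a ∷ vs} (a∉vs ∷ distinct) = begin
  h a + sum (map h vs)             ≡⟨ cong (λ s → h a + sum s) (map-cong-local unchanged) ⟩
  h a + sum (map (zeroAt a h) vs)  ≤⟨ +-monoʳ-≤ (h a) (sum-map≤∑ (zeroAt a h) distinct) ⟩
  h a + ∑ (zeroAt a h)             ≡⟨ sym (∑-zeroAt a h) ⟩
  ∑ h                              ∎
  where
  open ℕ.≤-Reasoning
  unchanged : All (λ b → h b ≡ zeroAt a h b) vs
  unchanged = All.map (λ a≢b → sym (zeroAt-≢ a h (≢-sym a≢b))) a∉vs

least-witness : {P : ℕ → Set} → (∀ k → Dec (P k)) → ∀ {m} → P m →
                ∃[ d ] (P d × d ≤ m × (∀ k → P k → d ≤ k))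
least-witness {P} P? {m} = <-rec Least search m
  where
  Least : ℕ → Set
  Least m = P m → ∃[ d ] (P d × d ≤ m × (∀ k → P k → d ≤ k))
  search : ∀ m → (∀ {j} → j < m → Least j) → Least m
  search m smaller Pm with anyUpTo? P? m
  ... | yes (j , j<m , Pj) =
    let d , Pd , d≤j , least = smaller j<m Pj in d , Pd , ≤-trans d≤j (<⇒≤ j<m) , least
  ... | no none = m , Pm , ≤-refl , λ k Pk → ≮⇒≥ λ k<m → none (k , k<m , Pk)

addEdge-adj : (A : Fin n → Fin n → Bool) (x y : Fin n) {p q : Fin n} →
              Adj (addEdge A x y) p q → Adj A p q ⊎ ((p ≡ x × q ≡ y) ⊎ (p ≡ y × q ≡ x))
addEdge-adj A x y {p} {q} with A p q | p ≟ x | q ≟ y | p ≟ y | q ≟ x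
... | true  | _       | _       | _       | _       = λ _ → inj₁ refl
... | false | yes p≡x | yes q≡y | _       | _       = λ _ → inj₂ (inj₁ (p≡x , q≡y))
... | false | _       | _       | yes p≡y | yes q≡x = λ _ → inj₂ (inj₂ (p≡y , q≡x))
... | false | no _    | _       | no _    | _       = λ ()
... | false | no _    | _       | yes _   | no _    = λ ()
... | false | yes _   | no _    | no _    | _       = λ ()
... | false | yes _   | no _    | yes _   | no _    = λ ()

addEdge-comm : (A : Fin n → Fin n → Bool) (x y : Fin n) →
               ∀ p q → addEdge A x y p q ≡ addEdge A y x p q
addEdge-comm A x y p q = cong (A p q ∨_) (Bool.∨-comm (⌊ p ≟ x ⌋ ∧ ⌊ q ≟ y ⌋) (⌊ p ≟ y ⌋ ∧ ⌊ q ≟ x ⌋))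

IsTRDF-resp : {A B : Fin n → Fin n → Bool} {f : Fin n → Fin 3} →
              (∀ p q → A p q ≡ B p q) → IsTRDF A f → IsTRDF B f
IsTRDF-resp A≡B (dominated , paired) =
  (λ v fv≡0 → let u , v~u , fu≡2 = dominated v fv≡0 in u , trans (sym (A≡B v u)) v~u , fu≡2) ,
  (λ v fv≢0 → let u , v~u , fu≢0 = paired v fv≢0 in u , trans (sym (A≡B v u)) v~u , fu≢0)

trdf-support : {A : Fin n → Fin n → Bool} {f : Fin n → Fin 3} → IsTRDF A f →
               ∀ v → ∃[ w ] (Adj A v w × 2 ≤ toℕ (f v) + toℕ (f w))
trdf-support {f = f} (dominated , paired) v with toℕ (f v) ℕ.≟ 0
... | yes fv≡0 = let w , v~w , fw≡2 = dominated v fv≡0 in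
  w , v~w , ≤-reflexive (sym (cong₂ _+_ fv≡0 fw≡2))
... | no fv≢0 = let w , v~w , fw≢0 = paired v fv≢0 in
  w , v~w , +-mono-≤ (n≢0⇒n>0 fv≢0) (n≢0⇒n>0 fw≢0)

ClosedNbr : Graph n → Fin n → Fin n → Set
ClosedNbr G x v = v ≡ x ⊎ Adj (adj G) x v

Close : Graph n → Fin n → Fin n → Set
Close G x y = ∃[ k ] (Walk G x y k × k ≤ 3)

Far : Graph n → Fin n → Fin n → Set
Far G x y = ∀ {k} → Walk G x y k → 3 < k

module _ (G : Graph n) where

  private
    infix 4 _~_
    _~_ : Fin n → Fin n → Set
    _~_ = Adj (adj G)

  ~-sym : ∀ {u v} → u ~ v → v ~ u
  ~-sym {u} {v} u~v = trans (Graph.sym G v u) u~v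

  ~⇒≢ : ∀ {u v} → u ~ v → u ≢ v
  ~⇒≢ {u} u~u refl with trans (sym u~u) (irrefl G u)
  ... | ()

  walk-snoc : ∀ {u v w} → Walk G u v k → v ~ w → Walk G u w (suc k)
  walk-snoc here         v~w = step v~w here
  walk-snoc (step e W)   v~w = step e (walk-snoc W v~w)

  walk-reverse : ∀ {u v} → Walk G u v k → Walk G v u k
  walk-reverse here       = here
  walk-reverse (step e W) = walk-snoc (walk-reverse W) (~-sym e)

  walk? : ∀ k u v → Dec (Walk G u v k)
  walk? zero u v with u ≟ v
  ... | yes refl = yes here
  ... | no u≢v   = no λ { here → u≢v refl }
  walk? (suc k) u v with any? (λ w → (adj G u w Bool.≟ true) ×-dec walk? k w v)
  ... | yes (w , u~w , W) = yes (step u~w W)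
  ... | no none           = no λ { (step u~w W) → none (_ , u~w , W) }

  closedNbr? : ∀ x v → Dec (ClosedNbr G x v)
  closedNbr? x v = (v ≟ x) ⊎-dec (adj G x v Bool.≟ true)

  far-or-close : ∀ x y → Far G x y ⊎ Close G x y
  far-or-close x y with anyUpTo? (λ k → walk? k x y) 4
  ... | yes (k , k<4 , W) = inj₂ (k , W , ≤-pred k<4)
  ... | no none           = inj₁ λ W → ≮⇒≥ λ k<4 → none (_ , k<4 , W)

  far⇒¬close : ∀ {x y} → Far G x y → ¬ Close G x y
  far⇒¬close far (_ , W , k≤3) = <⇒≱ (far W) k≤3

  far-sym : ∀ {x y} → Far G x y → Far G y x
  far-sym far = far ∘ walk-reverse

  far⇒≢ : ∀ {x y} → Far G x y → x ≢ y
  far⇒≢ far refl = far⇒¬close far (0 , here , z≤n)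

  far⇒≁ : ∀ {x y} → Far G x y → ¬ x ~ y
  far⇒≁ far x~y = far⇒¬close far (1 , step x~y here , s≤s z≤n)

  far⇒nonEdge : ∀ {x y} → Far G x y → NonEdge G x y
  far⇒nonEdge far = far⇒≢ far , Bool.¬-not (far⇒≁ far)

  close⇒dist : ∀ {u v} → Close G u v → ∃[ d ] (Dist G u v d × d ≤ 3)
  close⇒dist {u} {v} (_ , W , k≤3) =
    let d , W′ , d≤k , least = least-witness (λ j → walk? j u v) W
    in d , (W′ , least) , ≤-trans d≤k k≤3

  bridge : ∀ {x y p q} → ClosedNbr G x p → p ~ q → ClosedNbr G y q → Close G x y
  bridge (inj₁ refl) p~q (inj₁ refl) = 1 , step p~q here , s≤s z≤n
  bridge (inj₁ refl) p~q (inj₂ y~q)  = 2 , step p~q (step (~-sym y~q) here) , s≤s (s≤s z≤n)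
  bridge (inj₂ x~p)  p~q (inj₁ refl) = 2 , step x~p (step p~q here) , s≤s (s≤s z≤n)
  bridge (inj₂ x~p)  p~q (inj₂ y~q)  = 3 , step x~p (step p~q (step (~-sym y~q) here)) , ≤-refl

  covered⇒close : ∀ {x y u} → (∀ v → ClosedNbr G x v ⊎ ClosedNbr G y v) →
                  ClosedNbr G x u → Walk G u y k → Close G x y
  covered⇒close cover (inj₁ refl) here = 0 , here , z≤n
  covered⇒close cover (inj₂ x~y)  here = 1 , step x~y here , s≤s z≤n
  covered⇒close cover u∈N[x] (step {w = u′} u~u′ W) with cover u′
  ... | inj₁ u′∈N[x] = covered⇒close cover u′∈N[x] W
  ... | inj₂ u′∈N[y] = bridge u∈N[x] u~u′ u′∈N[y]

  nonEdge-walk≤2 : ∀ {u v d} → NonEdge G u v → Walk G u v d → d ≤ 2 → d ≡ 2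
  nonEdge-walk≤2 (u≢v , _)   here                        _ = ⊥-elim (u≢v refl)
  nonEdge-walk≤2 (_ , u≁v)   (step u~v here)             _ with trans (sym u~v) u≁v
  ... | ()
  nonEdge-walk≤2 _           (step _ (step _ here))      _ = refl
  nonEdge-walk≤2 _           (step _ (step _ (step _ _))) (s≤s (s≤s ()))

  diameter-2-or-3 : (∀ u v → ∃[ d ] (Dist G u v d × d ≤ 3)) → ∃[ u ] ∃[ v ] NonEdge G u v →
                    ∃[ d ] (Diam G d × 2 ≤ d × d ≤ 3)
  diameter-2-or-3 dist (u₀ , v₀ , u₀≁v₀) with any? (λ u → any? λ v → proj₁ (dist u v) ℕ.≟ 3)
  ... | yes (u , v , d≡3) =
    3 , (dist , u , v , subst (Dist G u v) d≡3 (proj₁ (proj₂ (dist u v)))) , s≤s (s≤s z≤n) , ≤-refl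
  ... | no no-3 =
    2 , (dist≤2 , u₀ , v₀ , subst (Dist G u₀ v₀) d₀≡2 D₀) , ≤-refl , s≤s (s≤s z≤n)
    where
    dist≤2 : ∀ u v → ∃[ d ] (Dist G u v d × d ≤ 2)
    dist≤2 u v = let d , D , d≤3 = dist u v in
      d , D , ≤-pred (≤∧≢⇒< d≤3 λ d≡3 → no-3 (u , v , d≡3))
    D₀ = proj₁ (proj₂ (dist≤2 u₀ v₀))
    d₀≡2 : proj₁ (dist≤2 u₀ v₀) ≡ 2
    d₀≡2 = nonEdge-walk≤2 u₀≁v₀ (proj₁ D₀) (proj₂ (proj₂ (dist≤2 u₀ v₀)))

module EndpointConditions
  (G : Graph n) (connected : Connected G) (noIsolated : NoIsolated (adj G))
  {x y : Fin n} (far : Far G x y)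
  (g : Fin n → Fin 3) (trdf : IsTRDF (addEdge (adj G) x y) g) (light : weight g ≤ 4)
  where

  private
    infix 4 _~_
    _~_ : Fin n → Fin n → Set
    _~_ = Adj (adj G)

    h : Fin n → ℕ
    h = toℕ ∘ g

    x≢y : x ≢ y
    x≢y = far⇒≢ G far

    no-path₂ : ∀ {p} → x ~ p → p ~ y → ⊥
    no-path₂ x~p p~y = far⇒¬close G far (2 , step x~p (step p~y here) , s≤s (s≤s z≤n))

    no-path₃ : ∀ {p q} → x ~ p → p ~ q → q ~ y → ⊥
    no-path₃ x~p p~q q~y = far⇒¬close G far (3 , step x~p (step p~q (step q~y here)) , ≤-refl)

    nbr-of-x : ∀ {p} → x ~ p → p ≢ x × p ≢ y
    nbr-of-x x~p = ≢-sym (~⇒≢ G x~p) , λ { refl → far⇒≁ G far x~p }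

    h≡2⇒≢0 : ∀ {p} → h p ≡ 2 → h p ≢ 0
    h≡2⇒≢0 hp≡2 = subst (_≢ 0) (sym hp≡2) λ ()

    off-edge : ∀ {p q} → Adj (addEdge (adj G) x y) p q → p ≢ x → p ≢ y → p ~ q
    off-edge p→q p≢x p≢y with addEdge-adj (adj G) x y p→q
    ... | inj₁ p~q              = p~q
    ... | inj₂ (inj₁ (p≡x , _)) = ⊥-elim (p≢x p≡x)
    ... | inj₂ (inj₂ (p≡y , _)) = ⊥-elim (p≢y p≡y)

    from-y : ∀ {q} → Adj (addEdge (adj G) x y) y q → q ≢ x → y ~ q
    from-y y→q q≢x with addEdge-adj (adj G) x y y→q
    ... | inj₁ y~q              = y~q
    ... | inj₂ (inj₁ (y≡x , _)) = ⊥-elim (x≢y (sym y≡x))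
    ... | inj₂ (inj₂ (_ , q≡x)) = ⊥-elim (q≢x q≡x)

    support : ∀ {p} → p ≢ x → p ≢ y → ∃[ q ] (p ~ q × 2 ≤ h p + h q)
    support {p} p≢x p≢y = let q , p→q , bound = trdf-support trdf p in
      q , off-edge p→q p≢x p≢y , bound

    pair-sum : ∀ {p q} → 2 ≤ h p + h q → 2 ≤ sum (map h (p ∷ q ∷ []))
    pair-sum {p} {q} = subst (2 ≤_) (cong (h p +_) (sym (+-identityʳ (h q))))

    overweight : ∀ vs → Unique vs → 5 ≤ sum (map h vs) → ⊥
    overweight vs distinct heavy =
      <⇒≱ heavy (≤-trans (sum-map≤∑ h distinct) (subst (_≤ 4) (weight≡∑ g) light))

  zero-two-impossible : h x ≡ 0 → h y ≡ 2 → ⊥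
  zero-two-impossible hx≡0 hy≡2 with proj₂ trdf y (h≡2⇒≢0 hy≡2) | noIsolated x
  ... | a , y→a , ha≢0 | z , x~z with support (proj₁ (nbr-of-x x~z)) (proj₂ (nbr-of-x x~z))
  ... | w , z~w , 2≤hz+hw = overweight (y ∷ a ∷ z ∷ w ∷ []) distinct
        (+-mono-≤ (≤-reflexive (sym hy≡2)) (+-mono-≤ (n≢0⇒n>0 ha≢0) (pair-sum 2≤hz+hw)))
    where
    y~a : y ~ a
    y~a = from-y y→a λ { refl → ha≢0 hx≡0 }
    distinct : Unique (y ∷ a ∷ z ∷ w ∷ [])
    distinct = (~⇒≢ G y~a ∷ ≢-sym (proj₂ (nbr-of-x x~z)) ∷ (λ { refl → no-path₂ x~z z~w }) ∷ [])
             ∷ ((λ { refl → no-path₂ x~z (~-sym G y~a) }) ∷ (λ { refl → no-path₃ x~z z~w (~-sym G y~a) }) ∷ [])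
             ∷ (~⇒≢ G z~w ∷ [])
             ∷ [] ∷ []

  two-nonzero-impossible : h x ≡ 2 → h y ≢ 0 → ⊥
  two-nonzero-impossible hx≡2 hy≢0 =
    far⇒¬close G far (covered⇒close G covered (inj₁ refl) (proj₂ (connected x y)))
    where
    covered : ∀ v → ClosedNbr G x v ⊎ ClosedNbr G y v
    covered v with closedNbr? G x v | closedNbr? G y v
    ... | yes v∈N[x] | _          = inj₁ v∈N[x]
    ... | no _       | yes v∈N[y] = inj₂ v∈N[y]
    ... | no v∉N[x]  | no v∉N[y]  with support (v∉N[x] ∘ inj₁) (v∉N[y] ∘ inj₁)
    ... | w , v~w , 2≤hv+hw = ⊥-elim (overweight (x ∷ y ∷ v ∷ w ∷ []) distinct
          (+-mono-≤ (≤-reflexive (sym hx≡2)) (+-mono-≤ (n≢0⇒n>0 hy≢0) (pair-sum 2≤hv+hw))))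
      where
      distinct : Unique (x ∷ y ∷ v ∷ w ∷ [])
      distinct = (x≢y ∷ (v∉N[x] ∘ inj₁ ∘ sym) ∷ (λ { refl → v∉N[x] (inj₂ (~-sym G v~w)) }) ∷ [])
               ∷ ((v∉N[y] ∘ inj₁ ∘ sym) ∷ (λ { refl → v∉N[y] (inj₂ (~-sym G v~w)) }) ∷ [])
               ∷ (~⇒≢ G v~w ∷ [])
               ∷ [] ∷ []

  zero-neighbourhood-impossible : h x ≢ 0 → h x ≢ 2 → h y ≢ 0 → (∀ {u} → x ~ u → h u ≡ 0) → ⊥
  zero-neighbourhood-impossible hx≢0 hx≢2 hy≢0 zero-nbr with noIsolated x
  ... | z , x~z with proj₁ trdf z (zero-nbr x~z)
  ... | w , z→w , hw≡2 with proj₂ trdf w (h≡2⇒≢0 hw≡2)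
  ... | w′ , w→w′ , hw′≢0 = overweight (x ∷ y ∷ w ∷ w′ ∷ []) distinct
        (+-mono-≤ (n≢0⇒n>0 hx≢0) (+-mono-≤ (n≢0⇒n>0 hy≢0)
          (+-mono-≤ (≤-reflexive (sym hw≡2)) (+-mono-≤ (n≢0⇒n>0 hw′≢0) z≤n))))
    where
    z~w : z ~ w
    z~w = off-edge z→w (proj₁ (nbr-of-x x~z)) (proj₂ (nbr-of-x x~z))
    w≢x : w ≢ x
    w≢x refl = hx≢2 hw≡2
    w≢y : w ≢ y
    w≢y refl = no-path₂ x~z z~w
    w~w′ : w ~ w′
    w~w′ = off-edge w→w′ w≢x w≢y
    distinct : Unique (x ∷ y ∷ w ∷ w′ ∷ [])
    distinct = (x≢y ∷ ≢-sym w≢x ∷ (λ { refl → h≡2⇒≢0 hw≡2 (zero-nbr (~-sym G w~w′)) }) ∷ [])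
             ∷ (≢-sym w≢y ∷ (λ { refl → no-path₃ x~z z~w w~w′ }) ∷ [])
             ∷ (~⇒≢ G w~w′ ∷ [])
             ∷ [] ∷ []

  positive-neighbour : h x ≢ 0 → h y ≢ 0 → ∃[ u ] (x ~ u × h u ≢ 0)
  positive-neighbour hx≢0 hy≢0 with h x ℕ.≟ 2
  ... | yes hx≡2 = ⊥-elim (two-nonzero-impossible hx≡2 hy≢0)
  ... | no hx≢2 with any? (λ u → (adj G x u Bool.≟ true) ×-dec ¬? (h u ℕ.≟ 0))
  ...   | yes found = found
  ...   | no none   = ⊥-elim (zero-neighbourhood-impossible hx≢0 hx≢2 hy≢0 λ {u} x~u →
                        decidable-stable (h u ℕ.≟ 0) λ hu≢0 → none (u , x~u , hu≢0))

far⇒IsTRDF : (G : Graph n) → Connected G → NoIsolated (adj G) → ∀ {x y} → Far G x y →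
             (g : Fin n → Fin 3) → IsTRDF (addEdge (adj G) x y) g → weight g ≤ 4 →
             IsTRDF (adj G) g
far⇒IsTRDF G connected noIsolated {x} {y} far g trdf light = dominated , paired
  where
  module X = EndpointConditions G connected noIsolated far g trdf light
  module Y = EndpointConditions G connected noIsolated (far-sym G far) g
               (IsTRDF-resp (addEdge-comm (adj G) x y) trdf) light
  dominated : ∀ v → toℕ (g v) ≡ 0 → ∃[ u ] (Adj (adj G) v u × toℕ (g u) ≡ 2)
  dominated v gv≡0 with proj₁ trdf v gv≡0
  ... | u , v→u , gu≡2 with addEdge-adj (adj G) x y v→u
  ...   | inj₁ v~u                  = u , v~u , gu≡2
  ...   | inj₂ (inj₁ (refl , refl)) = ⊥-elim (X.zero-two-impossible gv≡0 gu≡2)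
  ...   | inj₂ (inj₂ (refl , refl)) = ⊥-elim (Y.zero-two-impossible gv≡0 gu≡2)
  paired : ∀ v → toℕ (g v) ≢ 0 → ∃[ u ] (Adj (adj G) v u × toℕ (g u) ≢ 0)
  paired v gv≢0 with proj₂ trdf v gv≢0
  ... | u , v→u , gu≢0 with addEdge-adj (adj G) x y v→u
  ...   | inj₁ v~u                  = u , v~u , gu≢0
  ...   | inj₂ (inj₁ (refl , refl)) = X.positive-neighbour gv≢0 gu≢0
  ...   | inj₂ (inj₂ (refl , refl)) = Y.positive-neighbour gv≢0 gu≢0

supercritical⇒close : (G : Graph n) → Connected G → EdgeSupercritical 6 G → ∀ x y → Close G x y
supercritical⇒close G connected (noIsolated , (_ , minimal) , _ , supercritical) x y
  with far-or-close G x y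
... | inj₂ close = close
... | inj₁ far =
  let g , trdf , light = supercritical x y (far⇒nonEdge G far)
      six≤weight = minimal g (far⇒IsTRDF G connected noIsolated far g trdf light)
  in ⊥-elim (<⇒≱ (≤-trans (n≤1+n 5) six≤weight) light)

proposition6p2 : (n : ℕ) (G : Graph n) → Connected G → EdgeSupercritical 6 G →
    ∃[ d ] (Diam G d × 2 ≤ d × d ≤ 3)
proposition6p2 n G connected supercritical =
  diameter-2-or-3 G (λ u v → close⇒dist G (supercritical⇒close G connected supercritical u v))
                    (proj₁ (proj₂ (proj₂ supercritical)))
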